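{- Let $k\ge 1$ be an integer. Then $R_n^{(=k,0,0,0)}(x)=n!$ for $1\le n\le k$, for every $s\ge1$ \[ R_{k+s}^{(=k,0,0,0)}(x)=k!\prod_{i=1}^{s}(k+i-1+x), \] and \[ P^{(=k,0,0,0)}(t,x):=\sum_{n\ge k}\frac{t^{n-k}}{(n-k)!}R_n^{(=k,0,0,0)}(x)=\frac{k!}{(1-t)^{x+k}}. \]
   Context: For $\sigma=\sigma_1\cdots\sigma_n\in S_n$ and an index $i$, quadrant I relative to $(i,\sigma_i)$ consists of the points $(j,\sigma_j)$ with $j>i$ and $\sigma_j>\sigma_i$. $\sigma_i$ matches $MMP(=k,0,0,0)$ if there are exactly $k$ points in quadrant I. $mmp^{(=k,0,0,0)}(\sigma)$ is the number of $i$ such that $\sigma_i$ matches $MMP(=k,0,0,0)$, and $R_n^{(=k,0,0,0)}(x)=\sum_{\sigma\in S_n}x^{mmp^{(=k,0,0,0)}(\sigma)}$. -}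

module Defs where

open import Data.Nat using (ℕ; zero; suc; _+_; _*_; _≟_; _!)

open import Data.Fin using (Fin) renaming (_<?_ to _<ᶠ?_)
import Data.Fin.Properties as FinP
open import Data.List using (List; []; _∷_; map; concatMap; filter; length; allFin)
open import Data.Vec using (Vec; []; _∷_; lookup; toList)
open import Relation.Nullary.Decidable using (_×-dec_)
import Data.List.Relation.Unary.Unique.DecPropositional as UDec

allVecs : (m n : ℕ) → List (Vec (Fin n) m)
allVecs zero    n = [] ∷ []
allVecs (suc m) n = concatMap (λ i → map (i ∷_) (allVecs m n)) (allFin n)

-- S_n: permutations in one-line notation σ₁⋯σₙ (values in Fin n, pairwise distinct);
-- each permutation occurs exactly once in this list.
Perms : (n : ℕ) → List (Vec (Fin n) n)
Perms n = filter (λ σ → UDec.unique? (FinP._≟_ {n}) (toList σ)) (allVecs n n)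

quadI : {n : ℕ} → Vec (Fin n) n → Fin n → ℕ
quadI {n} σ i = length (filter (λ j → (i <ᶠ? j) ×-dec (lookup σ i <ᶠ? lookup σ j)) (allFin n))

mmp : (k : ℕ) {n : ℕ} → Vec (Fin n) n → ℕ
mmp k {n} σ = length (filter (λ i → quadI σ i ≟ k) (allFin n))

-- R_n^{(=k,0,0,0)}(x) as a polynomial in x, given by its coefficients:
-- coefficient of x^m = #{σ ∈ S_n : mmp σ = m}.
Rcoeff : (k n m : ℕ) → ℕ
Rcoeff k n m = length (filter (λ σ → mmp k σ ≟ m) (Perms n))

-- Polynomials over ℕ in x as coefficient lists (constant term first).
Poly : Set
Poly = List ℕ

coeff : Poly → ℕ → ℕ
coeff []       _       = 0
coeff (a ∷ p)  zero    = a
coeff (a ∷ p)  (suc m) = coeff p m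

scale : ℕ → Poly → Poly
scale c = map (c *_)

addP : Poly → Poly → Poly
addP []      q       = q
addP p       []      = p
addP (a ∷ p) (b ∷ q) = (a + b) ∷ addP p q

mulLin : ℕ → Poly → Poly
mulLin c p = addP (scale c p) (0 ∷ p)

prodLin : ℕ → ℕ → Poly
prodLin k zero    = 1 ∷ []
prodLin k (suc s) = mulLin (k + s) (prodLin k s)

rhsPoly : ℕ → ℕ → Poly
rhsPoly k s = scale (k !) (prodLin k s)

-- Write σ ∈ S_{n+1} as σ = v ∷ map (punchIn v) τ with τ ∈ S_n. Quadrant I of every later
-- point of σ is that of the corresponding point of τ, since punchIn v preserves order, and
-- quadrant I of the first point holds exactly the n − v larger values. Hence
-- R_{n+1}(x) = Σ_v x^[n − v = k] R_n(x): for n < k this is (n+1) R_n(x), and for n ≥ k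
-- exactly one v contributes x, so R_{n+1}(x) = (n + x) R_n(x). Iterating from R_0 = 1
-- gives R_n = n! for n ≤ k and R_{k+s} = k! ∏_{i=1}^{s} (k+i-1+x).
module Submission where

open import Defs
open import Data.Nat using (ℕ; zero; suc; _+_; _*_; _∸_; _≤_; _<_; z≤n; s≤s; _≟_; _!)
import Data.Nat as ℕ
import Data.Nat.Properties as ℕP
open import Algebra.Properties.CommutativeSemigroup ℕP.+-commutativeSemigroup
  using () renaming (x∙yz≈y∙xz to +-left-comm)
open import Data.Bool using (Bool; true; false; not; _∧_)
open import Data.Bool.Properties using (∧-assoc; ∧-zeroʳ)
open import Data.Fin using (Fin; zero; suc; toℕ; punchIn)
import Data.Fin.Properties as FinP
open import Data.Nat.Tactic.RingSolver using (solve-∀)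
open import Data.List using (List; []; _∷_; concatMap; filter; length; allFin; tabulate; _++_)
import Data.List as List
open import Data.List.Properties using (length-tabulate; map-tabulate)
open import Data.List.Membership.Propositional using (_∈_)
open import Data.List.Membership.Propositional.Properties using (∈-allFin)
open import Data.List.Relation.Unary.All as All using (All; []; _∷_)
open import Data.List.Relation.Unary.Any using (here; there)
open import Data.List.Relation.Unary.AllPairs using (AllPairs; []; _∷_)
import Data.List.Relation.Unary.Unique.DecPropositional as UniqueDec
open import Data.Vec using (Vec; []; _∷_; lookup; toList; map)
open import Data.Vec.Properties using (lookup-map; length-toList)
open import Data.Product using (_×_; _,_)
open import Data.Empty using (⊥-elim)
open import Function using (_∘_; id)
open import Relation.Nullary using (Dec; yes; no; does; ¬?)
open import Relation.Nullary.Decidable using (dec-true; dec-false)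
open import Relation.Unary using (Pred; Decidable)
open import Relation.Binary.PropositionalEquality

private
  variable
    A B : Set

boolToℕ : Bool → ℕ
boolToℕ true  = 1
boolToℕ false = 0

sumBy : (A → ℕ) → List A → ℕ
sumBy f []       = 0
sumBy f (x ∷ xs) = f x + sumBy f xs

count : (A → Bool) → List A → ℕ
count f = sumBy (boolToℕ ∘ f)

sumBy-cong : {f g : A → ℕ} → f ≗ g → ∀ xs → sumBy f xs ≡ sumBy g xs
sumBy-cong f≗g []       = refl
sumBy-cong f≗g (x ∷ xs) = cong₂ _+_ (f≗g x) (sumBy-cong f≗g xs)

count-cong : {f g : A → Bool} → f ≗ g → ∀ xs → count f xs ≡ count g xs
count-cong f≗g = sumBy-cong (cong boolToℕ ∘ f≗g)

sumBy-zero : (xs : List A) → sumBy (λ _ → 0) xs ≡ 0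
sumBy-zero []       = refl
sumBy-zero (x ∷ xs) = sumBy-zero xs

sumBy-++ : (f : A → ℕ) (xs ys : List A) → sumBy f (xs ++ ys) ≡ sumBy f xs + sumBy f ys
sumBy-++ f []       ys = refl
sumBy-++ f (x ∷ xs) ys = trans (cong (f x +_) (sumBy-++ f xs ys)) (sym (ℕP.+-assoc (f x) _ _))

sumBy-map : (f : B → ℕ) (h : A → B) (xs : List A) → sumBy f (List.map h xs) ≡ sumBy (f ∘ h) xs
sumBy-map f h []       = refl
sumBy-map f h (x ∷ xs) = cong (f (h x) +_) (sumBy-map f h xs)

sumBy-concatMap : (f : B → ℕ) (h : A → List B) (xs : List A) →
                  sumBy f (concatMap h xs) ≡ sumBy (sumBy f ∘ h) xs
sumBy-concatMap f h []       = refl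
sumBy-concatMap f h (x ∷ xs) =
  trans (sumBy-++ f (h x) (concatMap h xs)) (cong (sumBy f (h x) +_) (sumBy-concatMap f h xs))

sumBy-allFin-suc : (n : ℕ) (f : Fin (suc n) → ℕ) →
                   sumBy f (allFin (suc n)) ≡ f zero + sumBy (f ∘ suc) (allFin n)
sumBy-allFin-suc n f = cong (f zero +_) (begin
  sumBy f (tabulate suc)                ≡⟨ cong (sumBy f) (map-tabulate id suc) ⟨
  sumBy f (List.map suc (allFin n))     ≡⟨ sumBy-map f suc (allFin n) ⟩
  sumBy (f ∘ suc) (allFin n)            ∎)
  where open ≡-Reasoning

sumBy-allFin-punchIn : (n : ℕ) (p : Fin (suc n)) (f : Fin (suc n) → ℕ) →
                       sumBy f (allFin (suc n)) ≡ f p + sumBy (f ∘ punchIn p) (allFin n)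
sumBy-allFin-punchIn n       zero    f = sumBy-allFin-suc n f
sumBy-allFin-punchIn (suc n) (suc p) f = begin
  sumBy f (allFin (suc (suc n)))                            ≡⟨ sumBy-allFin-suc (suc n) f ⟩
  f zero + sumBy (f ∘ suc) (allFin (suc n))                 ≡⟨ cong (f zero +_) (sumBy-allFin-punchIn n p (f ∘ suc)) ⟩
  f zero + (f (suc p) + rest)                               ≡⟨ +-left-comm (f zero) (f (suc p)) rest ⟩
  f (suc p) + (f zero + rest)                               ≡⟨ cong (f (suc p) +_) (sumBy-allFin-suc n (f ∘ punchIn (suc p))) ⟨
  f (suc p) + sumBy (f ∘ punchIn (suc p)) (allFin (suc n))  ∎
  where
  open ≡-Reasoning
  rest = sumBy (f ∘ suc ∘ punchIn p) (allFin n)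

length-filter-count : ∀ {p} {P : Pred A p} (P? : Decidable P) (xs : List A) →
                      length (filter P? xs) ≡ count (does ∘ P?) xs
length-filter-count P? []       = refl
length-filter-count P? (x ∷ xs) with does (P? x)
... | true  = cong suc (length-filter-count P? xs)
... | false = length-filter-count P? xs

count-filter : ∀ {p} {P : Pred A p} (P? : Decidable P) (f : A → Bool) (xs : List A) →
               count f (filter P? xs) ≡ count (λ x → does (P? x) ∧ f x) xs
count-filter P? f []       = refl
count-filter P? f (x ∷ xs) with does (P? x)
... | true  = cong (boolToℕ (f x) +_) (count-filter P? f xs)
... | false = count-filter P? f xs

count-not : (f : A → Bool) (xs : List A) → count f xs + count (not ∘ f) xs ≡ length xs
count-not f []       = refl
count-not f (x ∷ xs) with f x
... | true  = cong suc (count-not f xs)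
... | false = trans (ℕP.+-suc _ _) (cong suc (count-not f xs))

does-⇔ : ∀ {a b} {P : Set a} {Q : Set b} (P? : Dec P) (Q? : Dec Q) → (P → Q) → (Q → P) → does P? ≡ does Q?
does-⇔ (yes p) Q? to from = sym (dec-true Q? (to p))
does-⇔ (no ¬p) Q? to from = sym (dec-false Q? (¬p ∘ from))

does-∧-cong : ∀ {p} {P : Set p} (P? : Dec P) {x y : Bool} → (P → x ≡ y) → does P? ∧ x ≡ does P? ∧ y
does-∧-cong (yes p) x≡y = x≡y p
does-∧-cong (no _)  x≡y = refl

-- Reindexing a count along a duplicate-free enumeration of Fin N

module _ {N : ℕ} where

  remove : Fin N → List (Fin N) → List (Fin N)
  remove x []       = []
  remove x (y ∷ ys) with x FinP.≟ y
  ... | yes _ = ys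
  ... | no  _ = y ∷ remove x ys

  count-remove : (f : Fin N → Bool) (x : Fin N) (ys : List (Fin N)) → x ∈ ys →
                 count f ys ≡ boolToℕ (f x) + count f (remove x ys)
  count-remove f x (y ∷ ys) x∈ with x FinP.≟ y
  ... | yes refl = refl
  count-remove f x (y ∷ ys) (here x≡y)  | no x≢y = ⊥-elim (x≢y x≡y)
  count-remove f x (y ∷ ys) (there x∈) | no _   =
    trans (cong (boolToℕ (f y) +_) (count-remove f x ys x∈)) (+-left-comm (boolToℕ (f y)) (boolToℕ (f x)) _)

  ∈-remove : (x y : Fin N) (ys : List (Fin N)) → y ∈ ys → x ≢ y → y ∈ remove x ys
  ∈-remove x y (z ∷ ys) y∈ x≢y with x FinP.≟ z
  ∈-remove x y (z ∷ ys) (here refl) x≢y | yes refl = ⊥-elim (x≢y refl)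
  ∈-remove x y (z ∷ ys) (there y∈) x≢y | yes refl = y∈
  ∈-remove x y (z ∷ ys) (here y≡z)  x≢y | no _     = here y≡z
  ∈-remove x y (z ∷ ys) (there y∈) x≢y | no _     = there (∈-remove x y ys y∈ x≢y)

  count-mono-⊆ : (f : Fin N → Bool) (xs ys : List (Fin N)) →
                 AllPairs _≢_ xs → All (_∈ ys) xs → count f xs ≤ count f ys
  count-mono-⊆ f []       ys []           []         = z≤n
  count-mono-⊆ f (x ∷ xs) ys (x∉xs ∷ xs!) (x∈ ∷ xs⊆) =
    subst (boolToℕ (f x) + count f xs ≤_) (sym (count-remove f x ys x∈))
      (ℕP.+-monoʳ-≤ (boolToℕ (f x)) (count-mono-⊆ f xs (remove x ys) xs! (xs⊆remove xs⊆ x∉xs)))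
    where
    xs⊆remove : ∀ {zs} → All (_∈ ys) zs → All (x ≢_) zs → All (_∈ remove x ys) zs
    xs⊆remove []         []           = []
    xs⊆remove (z∈ ∷ zs⊆) (x≢z ∷ x∉zs) = ∈-remove x _ ys z∈ x≢z ∷ xs⊆remove zs⊆ x∉zs

  -- Both f and not ∘ f can only lose on xs ⊆ allFin N, while their totals agree.
  count-unique-allFin : (f : Fin N → Bool) (xs : List (Fin N)) → AllPairs _≢_ xs → length xs ≡ N →
                        count f xs ≡ count f (allFin N)
  count-unique-allFin f xs xs! |xs|≡N = ℕP.≤-antisym (≤-allFin f) (ℕP.+-cancelʳ-≤ _ _ _ (begin
      count f (allFin N) + count (not ∘ f) xs
        ≤⟨ ℕP.+-monoʳ-≤ (count f (allFin N)) (≤-allFin (not ∘ f)) ⟩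
      count f (allFin N) + count (not ∘ f) (allFin N)
        ≡⟨ count-not f (allFin N) ⟩
      length (allFin N)
        ≡⟨ length-tabulate id ⟩
      N
        ≡⟨ trans (count-not f xs) |xs|≡N ⟨
      count f xs + count (not ∘ f) xs ∎))
    where
    open ℕP.≤-Reasoning
    ≤-allFin : (g : Fin N → Bool) → count g xs ≤ count g (allFin N)
    ≤-allFin g = count-mono-⊆ g xs (allFin N) xs! (All.tabulate (λ {x} _ → ∈-allFin x))

isPerm : {a b : ℕ} → Vec (Fin a) b → Bool
isPerm {a} σ = does (UniqueDec.unique? (FinP._≟_ {a}) (toList σ))

avoids : {a b : ℕ} → Fin a → Vec (Fin a) b → Bool
avoids {a} v w = does (All.all? (λ x → ¬? (v FinP.≟ x)) (toList w))

quadrantI : {a b : ℕ} → Vec (Fin a) b → Fin b → ℕ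
quadrantI {b = b} σ i = count (λ j → does (i FinP.<? j) ∧ does (lookup σ i FinP.<? lookup σ j)) (allFin b)

mmpCount : ℕ → {a b : ℕ} → Vec (Fin a) b → ℕ
mmpCount k {b = b} σ = count (λ i → does (quadrantI σ i ≟ k)) (allFin b)

mmp≡mmpCount : (k : ℕ) {n : ℕ} (σ : Vec (Fin n) n) → mmp k σ ≡ mmpCount k σ
mmp≡mmpCount k {n} σ = trans (length-filter-count _ (allFin n))
  (count-cong (λ i → cong (λ q → does (q ≟ k)) (length-filter-count _ (allFin n))) (allFin n))

Rcoeff≡count : (k n m : ℕ) → Rcoeff k n m ≡ count (λ σ → isPerm σ ∧ does (mmpCount k σ ≟ m)) (allVecs n n)
Rcoeff≡count k n m = trans (length-filter-count _ (Perms n))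
  (trans (count-filter _ (λ σ → does (mmp k σ ≟ m)) (allVecs n n))
         (count-cong (λ σ → cong (λ c → isPerm σ ∧ does (c ≟ m)) (mmp≡mmpCount k σ)) (allVecs n n)))

count-allFin-suc : (n : ℕ) (f : Fin (suc n) → Bool) →
                   count f (allFin (suc n)) ≡ boolToℕ (f zero) + count (f ∘ suc) (allFin n)
count-allFin-suc n f = sumBy-allFin-suc n (boolToℕ ∘ f)

quadrantI-∷-suc : {a b : ℕ} (v : Fin a) (w : Vec (Fin a) b) (i : Fin b) →
                  quadrantI (v ∷ w) (suc i) ≡ quadrantI w i
quadrantI-∷-suc {b = b} v w i = begin
  count inQuadrant (allFin (suc b))
    ≡⟨ count-allFin-suc b inQuadrant ⟩
  boolToℕ (does (suc i FinP.<? zero {b}) ∧ above zero) + count (inQuadrant ∘ suc) (allFin b)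
    ≡⟨ cong (λ c → boolToℕ (c ∧ above zero) + count (inQuadrant ∘ suc) (allFin b))
            (dec-false (suc i FinP.<? zero {b}) λ ()) ⟩
  count (inQuadrant ∘ suc) (allFin b)
    ≡⟨ count-cong (λ j → cong (_∧ above (suc j)) (does-⇔ (suc i FinP.<? suc j) (i FinP.<? j) ℕ.s<s⁻¹ ℕ.s<s))
                  (allFin b) ⟩
  quadrantI w i ∎
  where
  open ≡-Reasoning
  above inQuadrant : Fin (suc b) → Bool
  above j = does (lookup w i FinP.<? lookup (v ∷ w) j)
  inQuadrant j = does (suc i FinP.<? j) ∧ above j

quadrantI-∷-zero : {a b : ℕ} (v : Fin a) (w : Vec (Fin a) b) →
                   quadrantI (v ∷ w) zero ≡ count (λ j → does (v FinP.<? lookup w j)) (allFin b)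
quadrantI-∷-zero {b = b} v w = begin
  count inQuadrant (allFin (suc b))
    ≡⟨ count-allFin-suc b inQuadrant ⟩
  boolToℕ (does (zero {b} FinP.<? zero {b}) ∧ above zero) + count (inQuadrant ∘ suc) (allFin b)
    ≡⟨ cong (λ c → boolToℕ (c ∧ above zero) + count (inQuadrant ∘ suc) (allFin b))
            (dec-false (zero {b} FinP.<? zero {b}) λ ()) ⟩
  count (inQuadrant ∘ suc) (allFin b)
    ≡⟨ count-cong (λ j → cong (_∧ above (suc j)) (dec-true (zero {b} FinP.<? suc j) (s≤s z≤n))) (allFin b) ⟩
  count (above ∘ suc) (allFin b) ∎
  where
  open ≡-Reasoning
  above inQuadrant : Fin (suc b) → Bool
  above j = does (v FinP.<? lookup (v ∷ w) j)
  inQuadrant j = does (zero {b} FinP.<? j) ∧ above j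

mmpCount-∷ : (k : ℕ) {a b : ℕ} (v : Fin a) (w : Vec (Fin a) b) →
             mmpCount k (v ∷ w)
               ≡ boolToℕ (does (count (λ j → does (v FinP.<? lookup w j)) (allFin b) ≟ k)) + mmpCount k w
mmpCount-∷ k {b = b} v w = trans (count-allFin-suc b _)
  (cong₂ _+_ (cong (λ q → boolToℕ (does (q ≟ k))) (quadrantI-∷-zero v w))
             (count-cong (λ i → cong (λ q → does (q ≟ k)) (quadrantI-∷-suc v w i)) (allFin b)))

does-punchIn-< : {n : ℕ} (p : Fin (suc n)) (x y : Fin n) →
              does (punchIn p x FinP.<? punchIn p y) ≡ does (x FinP.<? y)
does-punchIn-< p x y = does-⇔ (punchIn p x FinP.<? punchIn p y) (x FinP.<? y)
  (λ lt → ℕP.≰⇒> (ℕP.<⇒≱ lt ∘ FinP.punchIn-mono-≤ p y x))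
  (λ lt → ℕP.≰⇒> (ℕP.<⇒≱ lt ∘ FinP.punchIn-cancel-≤ p y x))

quadrantI-punchIn : {n b : ℕ} (p : Fin (suc n)) (τ : Vec (Fin n) b) (i : Fin b) →
                    quadrantI (map (punchIn p) τ) i ≡ quadrantI τ i
quadrantI-punchIn {b = b} p τ i = count-cong (λ j → cong (does (i FinP.<? j) ∧_) (begin
    does (lookup (map (punchIn p) τ) i FinP.<? lookup (map (punchIn p) τ) j)
      ≡⟨ cong₂ (λ x y → does (x FinP.<? y)) (lookup-map i (punchIn p) τ) (lookup-map j (punchIn p) τ) ⟩
    does (punchIn p (lookup τ i) FinP.<? punchIn p (lookup τ j))
      ≡⟨ does-punchIn-< p (lookup τ i) (lookup τ j) ⟩
    does (lookup τ i FinP.<? lookup τ j) ∎)) (allFin b)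
  where open ≡-Reasoning

mmpCount-punchIn : (k : ℕ) {n b : ℕ} (p : Fin (suc n)) (τ : Vec (Fin n) b) →
                   mmpCount k (map (punchIn p) τ) ≡ mmpCount k τ
mmpCount-punchIn k {b = b} p τ = count-cong (λ i → cong (λ q → does (q ≟ k)) (quadrantI-punchIn p τ i)) (allFin b)

avoids-punchIn : {n b : ℕ} (p : Fin (suc n)) (x : Fin n) (τ : Vec (Fin n) b) →
                 avoids (punchIn p x) (map (punchIn p) τ) ≡ avoids x τ
avoids-punchIn p x []      = refl
avoids-punchIn p x (y ∷ τ) = cong₂ (λ u v → not u ∧ v)
  (does-⇔ (punchIn p x FinP.≟ punchIn p y) (x FinP.≟ y) (FinP.punchIn-injective p x y) (cong (punchIn p)))
  (avoids-punchIn p x τ)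

isPerm-punchIn : {n b : ℕ} (p : Fin (suc n)) (τ : Vec (Fin n) b) → isPerm (map (punchIn p) τ) ≡ isPerm τ
isPerm-punchIn p []      = refl
isPerm-punchIn p (x ∷ τ) = cong₂ _∧_ (avoids-punchIn p x τ) (isPerm-punchIn p τ)

-- Splitting off the first letter of a permutation

count-allVecs-suc : (m N : ℕ) (g : Vec (Fin N) (suc m) → Bool) →
                    count g (allVecs (suc m) N) ≡ sumBy (λ v → count (g ∘ (v ∷_)) (allVecs m N)) (allFin N)
count-allVecs-suc m N g = trans (sumBy-concatMap _ (λ v → List.map (v ∷_) (allVecs m N)) (allFin N))
  (sumBy-cong (λ v → sumBy-map _ (v ∷_) (allVecs m N)) (allFin N))

-- The words over Fin (suc n) avoiding p are exactly the images of words over Fin n under punchIn p.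
count-avoids : (m n : ℕ) (p : Fin (suc n)) (g : Vec (Fin (suc n)) m → Bool) →
               count (λ w → avoids p w ∧ g w) (allVecs m (suc n)) ≡ count (g ∘ map (punchIn p)) (allVecs m n)
count-avoids zero    n p g = refl
count-avoids (suc m) n p g = begin
  count (λ w → avoids p w ∧ g w) (allVecs (suc m) (suc n))
    ≡⟨ count-allVecs-suc m (suc n) _ ⟩
  sumBy startingWith (allFin (suc n))
    ≡⟨ sumBy-allFin-punchIn n p startingWith ⟩
  startingWith p + sumBy (startingWith ∘ punchIn p) (allFin n)
    ≡⟨ cong₂ _+_ startingWith-p
                 (sumBy-cong (λ x → trans (startingWith-punchIn x) (count-avoids m n p (g ∘ (punchIn p x ∷_))))
                             (allFin n)) ⟩
  sumBy (λ x → count (g ∘ map (punchIn p) ∘ (x ∷_)) (allVecs m n)) (allFin n)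
    ≡⟨ count-allVecs-suc m n (g ∘ map (punchIn p)) ⟨
  count (g ∘ map (punchIn p)) (allVecs (suc m) n) ∎
  where
  open ≡-Reasoning
  startingWith : Fin (suc n) → ℕ
  startingWith v = count (λ w → avoids p (v ∷ w) ∧ g (v ∷ w)) (allVecs m (suc n))
  startingWith-p : startingWith p ≡ 0
  startingWith-p = trans
    (count-cong (λ w → cong (λ e → (not e ∧ avoids p w) ∧ g (p ∷ w)) (dec-true (p FinP.≟ p) refl)) (allVecs m (suc n)))
    (sumBy-zero (allVecs m (suc n)))
  startingWith-punchIn : (x : Fin n) →
                         startingWith (punchIn p x) ≡ count (λ w → avoids p w ∧ g (punchIn p x ∷ w)) (allVecs m (suc n))
  startingWith-punchIn x = count-cong (λ w → cong (λ e → (not e ∧ avoids p w) ∧ g (punchIn p x ∷ w))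
                                                (dec-false (p FinP.≟ punchIn p x) (FinP.punchInᵢ≢i p x ∘ sym)))
                                    (allVecs m (suc n))

count-≤-toℕ : (n c : ℕ) → count (λ x → does (c ℕ.≤? toℕ x)) (allFin n) ≡ n ∸ c
count-≤-toℕ zero    c       = sym (ℕP.0∸n≡0 c)
count-≤-toℕ (suc n) zero    =
  trans (count-allFin-suc n (λ x → does (0 ℕ.≤? toℕ x))) (cong suc (count-≤-toℕ n zero))
count-≤-toℕ (suc n) (suc c) = begin
  count (λ x → does (suc c ℕ.≤? toℕ x)) (allFin (suc n))
    ≡⟨ count-allFin-suc n (λ x → does (suc c ℕ.≤? toℕ x)) ⟩
  count (λ x → does (suc c ℕ.≤? suc (toℕ x))) (allFin n)
    ≡⟨ count-cong (λ x → does-⇔ (suc c ℕ.≤? suc (toℕ x)) (c ℕ.≤? toℕ x) ℕ.s≤s⁻¹ s≤s) (allFin n) ⟩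
  count (λ x → does (c ℕ.≤? toℕ x)) (allFin n)
    ≡⟨ count-≤-toℕ n c ⟩
  n ∸ c ∎
  where open ≡-Reasoning

does-<-punchIn : {n : ℕ} (v : Fin (suc n)) (x : Fin n) → does (v FinP.<? punchIn v x) ≡ does (toℕ v ℕ.≤? toℕ x)
does-<-punchIn {n}     zero    x       = trans (dec-true (zero {n} FinP.<? suc x) (s≤s z≤n)) (sym (dec-true (0 ℕ.≤? toℕ x) z≤n))
does-<-punchIn {suc n} (suc v) zero    = trans (dec-false (suc v FinP.<? zero {n}) λ ()) (sym (dec-false (suc (toℕ v) ℕ.≤? 0) λ ()))
does-<-punchIn         (suc v) (suc x) = begin
  does (suc v FinP.<? suc (punchIn v x))       ≡⟨ does-⇔ (suc v FinP.<? suc (punchIn v x)) (v FinP.<? punchIn v x) ℕ.s<s⁻¹ ℕ.s<s ⟩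
  does (v FinP.<? punchIn v x)                 ≡⟨ does-<-punchIn v x ⟩
  does (toℕ v ℕ.≤? toℕ x)                      ≡⟨ does-⇔ (toℕ v ℕ.≤? toℕ x) (suc (toℕ v) ℕ.≤? suc (toℕ x)) s≤s ℕ.s≤s⁻¹ ⟩
  does (suc (toℕ v) ℕ.≤? suc (toℕ x))          ∎
  where open ≡-Reasoning

count-lookup : {b : ℕ} (f : A → Bool) (τ : Vec A b) → count (f ∘ lookup τ) (allFin b) ≡ count f (toList τ)
count-lookup             f []      = refl
count-lookup {b = suc b} f (x ∷ τ) = trans (count-allFin-suc b _) (cong (boolToℕ (f x) +_) (count-lookup f τ))

count-above-first : {n : ℕ} (v : Fin (suc n)) (τ : Vec (Fin n) n) → AllPairs _≢_ (toList τ) →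
                    count (λ j → does (v FinP.<? punchIn v (lookup τ j))) (allFin n) ≡ n ∸ toℕ v
count-above-first {n} v τ τ-perm = begin
  count (λ j → does (v FinP.<? punchIn v (lookup τ j))) (allFin n)
    ≡⟨ count-cong (λ j → does-<-punchIn v (lookup τ j)) (allFin n) ⟩
  count (atLeast ∘ lookup τ) (allFin n)
    ≡⟨ count-lookup atLeast τ ⟩
  count atLeast (toList τ)
    ≡⟨ count-unique-allFin atLeast (toList τ) τ-perm (length-toList τ) ⟩
  count atLeast (allFin n)
    ≡⟨ count-≤-toℕ n (toℕ v) ⟩
  n ∸ toℕ v ∎
  where
  open ≡-Reasoning
  atLeast : Fin n → Bool
  atLeast x = does (toℕ v ℕ.≤? toℕ x)

mmpCount-∷-punchIn : (k : ℕ) {n : ℕ} (v : Fin (suc n)) (τ : Vec (Fin n) n) → AllPairs _≢_ (toList τ) →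
                     mmpCount k (v ∷ map (punchIn v) τ) ≡ boolToℕ (does (n ∸ toℕ v ≟ k)) + mmpCount k τ
mmpCount-∷-punchIn k {n} v τ τ-perm = begin
  mmpCount k (v ∷ map (punchIn v) τ)
    ≡⟨ mmpCount-∷ k v (map (punchIn v) τ) ⟩
  boolToℕ (does (count (λ j → does (v FinP.<? lookup (map (punchIn v) τ) j)) (allFin n) ≟ k))
    + mmpCount k (map (punchIn v) τ)
    ≡⟨ cong₂ (λ c r → boolToℕ (does (c ≟ k)) + r) first-point (mmpCount-punchIn k v τ) ⟩
  boolToℕ (does (n ∸ toℕ v ≟ k)) + mmpCount k τ ∎
  where
  open ≡-Reasoning
  first-point : count (λ j → does (v FinP.<? lookup (map (punchIn v) τ) j)) (allFin n) ≡ n ∸ toℕ v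
  first-point = trans (count-cong (λ j → cong (λ y → does (v FinP.<? y)) (lookup-map j (punchIn v) τ)) (allFin n))
                      (count-above-first v τ τ-perm)

sumUpTo : (ℕ → ℕ) → ℕ → ℕ
sumUpTo h zero    = h 0
sumUpTo h (suc n) = h (suc n) + sumUpTo h n

sumBy-allFin-∸ : (h : ℕ → ℕ) (n : ℕ) → sumBy (λ v → h (n ∸ toℕ v)) (allFin (suc n)) ≡ sumUpTo h n
sumBy-allFin-∸ h zero    = ℕP.+-identityʳ (h 0)
sumBy-allFin-∸ h (suc n) =
  trans (sumBy-allFin-suc (suc n) (λ v → h (suc n ∸ toℕ v))) (cong (h (suc n) +_) (sumBy-allFin-∸ h n))

sumUpTo-≟-< : (k : ℕ) (F : Bool → ℕ) (n : ℕ) → n < k → sumUpTo (λ d → F (does (d ≟ k))) n ≡ suc n * F false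
sumUpTo-≟-< k F zero    0<k   = trans (cong F (dec-false (0 ≟ k) (ℕP.<⇒≢ 0<k))) (sym (ℕP.+-identityʳ (F false)))
sumUpTo-≟-< k F (suc n) 1+n<k = cong₂ _+_ (cong F (dec-false (suc n ≟ k) (ℕP.<⇒≢ 1+n<k)))
                                          (sumUpTo-≟-< k F n (ℕP.<-trans (ℕP.n<1+n n) 1+n<k))

sumUpTo-≟-≥ : (k : ℕ) (F : Bool → ℕ) (n : ℕ) → k ≤ n → sumUpTo (λ d → F (does (d ≟ k))) n ≡ n * F false + F true
sumUpTo-≟-≥ .zero F zero    z≤n = cong F (dec-true (0 ≟ 0) refl)
sumUpTo-≟-≥ k     F (suc n) k≤1+n with k ≟ suc n
... | yes refl = trans (cong₂ _+_ (cong F (dec-true (suc n ≟ suc n) refl)) (sumUpTo-≟-< (suc n) F n (ℕP.n<1+n n)))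
                       (ℕP.+-comm (F true) _)
... | no  k≢1+n = trans (cong₂ _+_ (cong F (dec-false (suc n ≟ k) (k≢1+n ∘ sym)))
                                   (sumUpTo-≟-≥ k F n (ℕP.≤-pred (ℕP.≤∧≢⇒< k≤1+n k≢1+n))))
                        (sym (ℕP.+-assoc (F false) _ _))

-- The coefficient of x^m in x^e R_n(x).
shiftedRcoeff : (k n e m : ℕ) → ℕ
shiftedRcoeff k n e m = count (λ τ → isPerm τ ∧ does (e + mmpCount k τ ≟ m)) (allVecs n n)

Rcoeff-suc : (k n m : ℕ) → Rcoeff k (suc n) m ≡ sumUpTo (λ d → shiftedRcoeff k n (boolToℕ (does (d ≟ k))) m) n
Rcoeff-suc k n m = begin
  Rcoeff k (suc n) m
    ≡⟨ Rcoeff≡count k (suc n) m ⟩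
  count (λ σ → isPerm σ ∧ does (mmpCount k σ ≟ m)) (allVecs (suc n) (suc n))
    ≡⟨ count-allVecs-suc n (suc n) (λ σ → isPerm σ ∧ does (mmpCount k σ ≟ m)) ⟩
  sumBy (λ v → count (λ w → isPerm (v ∷ w) ∧ does (mmpCount k (v ∷ w) ≟ m)) (allVecs n (suc n))) (allFin (suc n))
    ≡⟨ sumBy-cong startingWith (allFin (suc n)) ⟩
  sumBy (λ v → shiftedRcoeff k n (boolToℕ (does (n ∸ toℕ v ≟ k))) m) (allFin (suc n))
    ≡⟨ sumBy-allFin-∸ (λ d → shiftedRcoeff k n (boolToℕ (does (d ≟ k))) m) n ⟩
  sumUpTo (λ d → shiftedRcoeff k n (boolToℕ (does (d ≟ k))) m) n ∎
  where
  open ≡-Reasoning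
  startingWith : (v : Fin (suc n)) →
                 count (λ w → isPerm (v ∷ w) ∧ does (mmpCount k (v ∷ w) ≟ m)) (allVecs n (suc n))
                   ≡ shiftedRcoeff k n (boolToℕ (does (n ∸ toℕ v ≟ k))) m
  startingWith v = begin
    count (λ w → isPerm (v ∷ w) ∧ does (mmpCount k (v ∷ w) ≟ m)) (allVecs n (suc n))
      ≡⟨ count-cong (λ w → ∧-assoc (avoids v w) (isPerm w) _) (allVecs n (suc n)) ⟩
    count (λ w → avoids v w ∧ (isPerm w ∧ does (mmpCount k (v ∷ w) ≟ m))) (allVecs n (suc n))
      ≡⟨ count-avoids n n v (λ w → isPerm w ∧ does (mmpCount k (v ∷ w) ≟ m)) ⟩
    count (λ τ → isPerm (map (punchIn v) τ) ∧ does (mmpCount k (v ∷ map (punchIn v) τ) ≟ m)) (allVecs n n)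
      ≡⟨ count-cong punched (allVecs n n) ⟩
    shiftedRcoeff k n (boolToℕ (does (n ∸ toℕ v ≟ k))) m ∎
    where
    punched : (τ : Vec (Fin n) n) →
              isPerm (map (punchIn v) τ) ∧ does (mmpCount k (v ∷ map (punchIn v) τ) ≟ m)
                ≡ isPerm τ ∧ does (boolToℕ (does (n ∸ toℕ v ≟ k)) + mmpCount k τ ≟ m)
    punched τ = trans (cong (_∧ does (mmpCount k (v ∷ map (punchIn v) τ) ≟ m)) (isPerm-punchIn v τ))
                      (does-∧-cong (UniqueDec.unique? FinP._≟_ (toList τ))
                                   (cong (λ c → does (c ≟ m)) ∘ mmpCount-∷-punchIn k v τ))

Rcoeff-suc-< : (k n m : ℕ) → n < k → Rcoeff k (suc n) m ≡ suc n * Rcoeff k n m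
Rcoeff-suc-< k n m n<k = begin
  Rcoeff k (suc n) m
    ≡⟨ Rcoeff-suc k n m ⟩
  sumUpTo (λ d → shiftedRcoeff k n (boolToℕ (does (d ≟ k))) m) n
    ≡⟨ sumUpTo-≟-< k (λ b → shiftedRcoeff k n (boolToℕ b) m) n n<k ⟩
  suc n * shiftedRcoeff k n 0 m
    ≡⟨ cong (suc n *_) (Rcoeff≡count k n m) ⟨
  suc n * Rcoeff k n m ∎
  where open ≡-Reasoning

Rcoeff-suc-≥ : (k n m : ℕ) → k ≤ n → Rcoeff k (suc n) m ≡ n * Rcoeff k n m + shiftedRcoeff k n 1 m
Rcoeff-suc-≥ k n m k≤n = begin
  Rcoeff k (suc n) m
    ≡⟨ Rcoeff-suc k n m ⟩
  sumUpTo (λ d → shiftedRcoeff k n (boolToℕ (does (d ≟ k))) m) n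
    ≡⟨ sumUpTo-≟-≥ k (λ b → shiftedRcoeff k n (boolToℕ b) m) n k≤n ⟩
  n * shiftedRcoeff k n 0 m + shiftedRcoeff k n 1 m
    ≡⟨ cong (λ r → n * r + shiftedRcoeff k n 1 m) (Rcoeff≡count k n m) ⟨
  n * Rcoeff k n m + shiftedRcoeff k n 1 m ∎
  where open ≡-Reasoning

shiftedRcoeff-1-zero : (k n : ℕ) → shiftedRcoeff k n 1 0 ≡ 0
shiftedRcoeff-1-zero k n = trans
  (count-cong (λ τ → trans (cong (isPerm τ ∧_) (dec-false (suc (mmpCount k τ) ≟ 0) λ ())) (∧-zeroʳ (isPerm τ)))
              (allVecs n n))
  (sumBy-zero (allVecs n n))

shiftedRcoeff-1-suc : (k n m : ℕ) → shiftedRcoeff k n 1 (suc m) ≡ Rcoeff k n m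
shiftedRcoeff-1-suc k n m = trans
  (count-cong (λ τ → cong (isPerm τ ∧_) (does-⇔ (suc (mmpCount k τ) ≟ suc m) (mmpCount k τ ≟ m) ℕP.suc-injective (cong suc)))
              (allVecs n n))
  (sym (Rcoeff≡count k n m))

coeff-scale : (c : ℕ) (p : Poly) → coeff (scale c p) ≗ (c *_) ∘ coeff p
coeff-scale c []      m       = sym (ℕP.*-zeroʳ c)
coeff-scale c (a ∷ p) zero    = refl
coeff-scale c (a ∷ p) (suc m) = coeff-scale c p m

coeff-addP : (p q : Poly) (m : ℕ) → coeff (addP p q) m ≡ coeff p m + coeff q m
coeff-addP []      q       m       = refl
coeff-addP (a ∷ p) []      m       = sym (ℕP.+-identityʳ _)
coeff-addP (a ∷ p) (b ∷ q) zero    = refl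
coeff-addP (a ∷ p) (b ∷ q) (suc m) = coeff-addP p q m

coeff-mulLin : (c : ℕ) (p : Poly) (m : ℕ) → coeff (mulLin c p) m ≡ c * coeff p m + coeff (0 ∷ p) m
coeff-mulLin c p m = trans (coeff-addP (scale c p) (0 ∷ p) m) (cong (_+ coeff (0 ∷ p) m) (coeff-scale c p m))

coeff-mulLin-scale : (c a : ℕ) (p : Poly) → coeff (mulLin c (scale a p)) ≗ coeff (scale a (mulLin c p))
coeff-mulLin-scale c a p m = begin
  coeff (mulLin c (scale a p)) m               ≡⟨ coeff-mulLin c (scale a p) m ⟩
  c * coeff (scale a p) m + coeff (0 ∷ scale a p) m
    ≡⟨ cong₂ (λ x y → c * x + y) (coeff-scale a p m) (coeff-shift-scale m) ⟩
  c * (a * coeff p m) + a * coeff (0 ∷ p) m    ≡⟨ factor-out c a (coeff p m) (coeff (0 ∷ p) m) ⟩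
  a * (c * coeff p m + coeff (0 ∷ p) m)        ≡⟨ cong (a *_) (coeff-mulLin c p m) ⟨
  a * coeff (mulLin c p) m                     ≡⟨ coeff-scale a (mulLin c p) m ⟨
  coeff (scale a (mulLin c p)) m               ∎
  where
  open ≡-Reasoning
  factor-out : ∀ c a x y → c * (a * x) + a * y ≡ a * (c * x + y)
  factor-out = solve-∀
  coeff-shift-scale : ∀ m → coeff (0 ∷ scale a p) m ≡ a * coeff (0 ∷ p) m
  coeff-shift-scale zero    = sym (ℕP.*-zeroʳ a)
  coeff-shift-scale (suc m) = coeff-scale a p m

Rcoeff-zero : (k : ℕ) → Rcoeff k 0 ≗ coeff (1 ∷ [])
Rcoeff-zero k zero    = Rcoeff≡count k 0 0
Rcoeff-zero k (suc m) = Rcoeff≡count k 0 (suc m)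

Rcoeff-suc-scale : (k n : ℕ) (p : Poly) → n < k → Rcoeff k n ≗ coeff p → Rcoeff k (suc n) ≗ coeff (scale (suc n) p)
Rcoeff-suc-scale k n p n<k Rₙ≗p m = begin
  Rcoeff k (suc n) m         ≡⟨ Rcoeff-suc-< k n m n<k ⟩
  suc n * Rcoeff k n m       ≡⟨ cong (suc n *_) (Rₙ≗p m) ⟩
  suc n * coeff p m          ≡⟨ coeff-scale (suc n) p m ⟨
  coeff (scale (suc n) p) m  ∎
  where open ≡-Reasoning

Rcoeff-suc-mulLin : (k n : ℕ) (p : Poly) → k ≤ n → Rcoeff k n ≗ coeff p → Rcoeff k (suc n) ≗ coeff (mulLin n p)
Rcoeff-suc-mulLin k n p k≤n Rₙ≗p m = begin
  Rcoeff k (suc n) m                        ≡⟨ Rcoeff-suc-≥ k n m k≤n ⟩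
  n * Rcoeff k n m + shiftedRcoeff k n 1 m  ≡⟨ cong₂ (λ r s → n * r + s) (Rₙ≗p m) (shifted m) ⟩
  n * coeff p m + coeff (0 ∷ p) m           ≡⟨ coeff-mulLin n p m ⟨
  coeff (mulLin n p) m                      ∎
  where
  open ≡-Reasoning
  shifted : ∀ m → shiftedRcoeff k n 1 m ≡ coeff (0 ∷ p) m
  shifted zero    = shiftedRcoeff-1-zero k n
  shifted (suc m) = trans (shiftedRcoeff-1-suc k n m) (Rₙ≗p m)

Rcoeff-≤ : (k n : ℕ) → n ≤ k → Rcoeff k n ≗ coeff (n ! ∷ [])
Rcoeff-≤ k zero    _     = Rcoeff-zero k
Rcoeff-≤ k (suc n) 1+n≤k = Rcoeff-suc-scale k n (n ! ∷ []) 1+n≤k (Rcoeff-≤ k n (ℕP.<⇒≤ 1+n≤k))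

Rcoeff-+ : (k s : ℕ) → Rcoeff k (k + s) ≗ coeff (rhsPoly k s)
Rcoeff-+ k zero    m = begin
  Rcoeff k (k + 0) m         ≡⟨ cong (λ n → Rcoeff k n m) (ℕP.+-identityʳ k) ⟩
  Rcoeff k k m               ≡⟨ Rcoeff-≤ k k ℕP.≤-refl m ⟩
  coeff (k ! ∷ []) m         ≡⟨ cong (λ a → coeff (a ∷ []) m) (ℕP.*-identityʳ (k !)) ⟨
  coeff (rhsPoly k 0) m      ∎
  where open ≡-Reasoning
Rcoeff-+ k (suc s) m = begin
  Rcoeff k (k + suc s) m                           ≡⟨ cong (λ n → Rcoeff k n m) (ℕP.+-suc k s) ⟩
  Rcoeff k (suc (k + s)) m                         ≡⟨ Rcoeff-suc-mulLin k (k + s) (rhsPoly k s) (ℕP.m≤m+n k s) (Rcoeff-+ k s) m ⟩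
  coeff (mulLin (k + s) (rhsPoly k s)) m           ≡⟨ coeff-mulLin-scale (k + s) (k !) (prodLin k s) m ⟩
  coeff (rhsPoly k (suc s)) m                      ∎
  where open ≡-Reasoning

mainTheorem3 : (k : ℕ) → 1 ≤ k →
    -- R_n(x) = n! for 1 ≤ n ≤ k
    ((n : ℕ) → 1 ≤ n → n ≤ k → (m : ℕ) → Rcoeff k n m ≡ coeff (n ! ∷ []) m)
    -- R_{k+s}(x) = k! ∏_{i=1}^{s} (k+i-1+x) for s ≥ 1
    × ((s : ℕ) → 1 ≤ s → (m : ℕ) → Rcoeff k (k + s) m ≡ coeff (rhsPoly k s) m)
    -- EGF identity P(t,x) = k!/(1-t)^{x+k}, compared coefficientwise in t^s/s! (all s ≥ 0)
    × ((s : ℕ) → (m : ℕ) → Rcoeff k (k + s) m ≡ coeff (rhsPoly k s) m)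
mainTheorem3 k _ = (λ n _ → Rcoeff-≤ k n) , (λ s _ → Rcoeff-+ k s) , Rcoeff-+ k
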